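{- Let $n,c$ be integers with $0<c<n$, and let $X$ be chosen uniformly at random from all $c$-element subsets of $\{1,\ldots,n\}$. Then for each $i\in\{0,1\}$, \[\Pr\Bigl[\sum_{x\in X}x\equiv i \pmod 2\Bigr]\le\begin{cases}\frac12 & n\text{ even},\ c\text{ odd};\\ \frac12\bigl(1+\frac1{n-1}\bigr) & n\text{ even},\ c\text{ even};\\ \frac12\bigl(1+\frac1n\bigr) & n\text{ odd}.\end{cases}\] -}

module Defs where

open import Data.Nat using (ℕ; zero; suc; _+_)
open import Data.Bool using (Bool; true; false)
open import Data.Vec using (Vec; []; _∷_)
open import Data.List using (List; []; _∷_; map; _++_; filter; length)
open import Data.Integer using (+_)
open import Data.Rational using (ℚ; 0ℚ; _/_)
open import Data.Fin.Subset using (Subset)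

-- All subsets of {1,…,n}; a subset is a 'Subset n = Vec Bool n' whose
-- k-th position (k = 0,…,n-1) encodes membership of the element k+1.
allSubsets : (n : ℕ) → List (Subset n)
allSubsets zero = [] ∷ []
allSubsets (suc n) = map (true ∷_) (allSubsets n) ++ map (false ∷_) (allSubsets n)

sumFrom : {m : ℕ} → ℕ → Vec Bool m → ℕ
sumFrom k [] = 0
sumFrom k (true ∷ v) = k + sumFrom (suc k) v
sumFrom k (false ∷ v) = sumFrom (suc k) v

subsetSum : {n : ℕ} → Subset n → ℕ
subsetSum = sumFrom 1

-- a / b as a rational number (b = 0 gives 0; never used with b = 0 below)
ratio : ℕ → ℕ → ℚ
ratio a zero = 0ℚ
ratio a (suc b) = (+ a) / suc b

-- Let G p be the number of c-subsets of {1, …, n} whose sum has parity p, so that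
-- G 0 + G 1 = C(n, c). A pair {k, k + 1} of consecutive integers contributes the factor
-- (1 + x)(1 − x) = 1 − x² to the signed generating polynomial Σₛ (−1)^(Σ s) x^∣s∣, so on
-- 2m consecutive integers ∣G 0 − G 1∣ is at most the absolute value h of the coefficient of
-- xᶜ in (1 − x²)ᵐ: C(m, c/2) for even c and 0 for odd c. For n = 2m + 1 the element 1 is set
-- aside first, which adds the coefficient of xᶜ⁻¹. Hence 2 G p ≤ C(n, c) + h, and the theorem
-- reduces to (n − 1) h ≤ C(n, c) for even n and n h ≤ C(n, c) for odd n, that is, to
--   (2m + 1) C(m, j) ≤ C(2m + 1, 2j)   (j ≥ 1)   and   (2m + 1) C(m, j) ≤ C(2m + 1, 2j + 1)   (j < m),
-- the first by induction on m through Pascal's rule applied twice, the second from the first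
-- by the symmetry C(N, k) = C(N, N − k).
module Submission where

open import Data.Bool using (true; false)
open import Data.Empty using (⊥-elim)
open import Data.Fin as Fin using (Fin; toℕ)
open import Data.Fin.Subset using (Subset; ∣_∣)
open import Data.Integer as ℤ using (+_; +≤+)
import Data.Integer.Properties as ℤ
open import Data.List using ([]; _∷_; _++_; map; filter; length)
open import Data.List.Properties using (filter-++; length-++; filter-none; filter-≐; length-filter)
open import Data.List.Relation.Unary.All using (universal)
open import Data.Nat
open import Data.Nat.Combinatorics using (_C_; nCk+nC[k+1]≡[n+1]C[k+1]; nCk≡nC[n∸k]; nC1≡n; k>n⇒nCk≡0)
open import Data.Nat.Properties
open import Algebra.Properties.CommutativeSemigroup +-commutativeSemigroup using (interchange)
open import Data.Nat.Tactic.RingSolver using (solve; solve-∀)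
open import Data.Parity.Base as ℙ using (Parity; 0ℙ; 1ℙ; _⁻¹)
open import Data.Parity.Properties as ℙ using (⁻¹-selfInverse; ⁻¹-involutive; +-homo-+)
open import Data.Product using (_×_; _,_; proj₁; proj₂)
open import Data.Rational as ℚ using (½; 1ℚ; toℚᵘ)
open import Data.Rational.Properties
  using (toℚᵘ-cancel-≤; toℚᵘ-fromℚᵘ; toℚᵘ-homo-*; toℚᵘ-homo-+; toℚᵘ-injective)
open import Data.Rational.Unnormalised as ℚᵘ using (mkℚᵘ; *≤*; *≡*)
import Data.Rational.Unnormalised.Properties as ℚᵘ
open import Data.Vec as Vec using ()
open import Function using (_∘_)
open import Level using (Level)
open import Relation.Binary.PropositionalEquality
open import Relation.Nullary using (yes; no; does)
open import Relation.Nullary.Decidable using (_×-dec_)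
open import Relation.Unary using (Pred; Decidable)
open import Defs

private variable
  ℓ ℓ′ : Level
  A B : Set ℓ′

-- Binomial estimates

C-pascal² : ∀ n k → suc (suc n) C suc (suc k) ≡ (n C k + n C suc k) + (n C suc k + n C suc (suc k))
C-pascal² n k = begin
  suc (suc n) C suc (suc k)                           ≡⟨ nCk+nC[k+1]≡[n+1]C[k+1] (suc n) (suc k) ⟨
  suc n C suc k + suc n C suc (suc k)                 ≡⟨ cong₂ _+_ (nCk+nC[k+1]≡[n+1]C[k+1] n k)
                                                                   (nCk+nC[k+1]≡[n+1]C[k+1] n (suc k)) ⟨
  (n C k + n C suc k) + (n C suc k + n C suc (suc k)) ∎
  where open ≡-Reasoning

k+l≡n⇒nCk≡nCl : ∀ k l {n} → k + l ≡ n → n C k ≡ n C l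
k+l≡n⇒nCk≡nCl k l refl = trans (nCk≡nC[n∸k] (m≤m+n k l)) (cong ((k + l) C_) (m+n∸m≡n k l))

nCk≤[1+n]Ck : ∀ n k → n C k ≤ suc n C k
nCk≤[1+n]Ck n zero    = ≤-refl
nCk≤[1+n]Ck n (suc k) = ≤-trans (m≤n+m (n C suc k) (n C k)) (≤-reflexive (nCk+nC[k+1]≡[n+1]C[k+1] n k))

aCk≤[a+b]C[k+l] : ∀ a b k l → l ≤ b → a C k ≤ (a + b) C (k + l)
aCk≤[a+b]C[k+l] a b k l l≤b rewrite +-comm a b | +-comm k l = go b l l≤b
  where
  go : ∀ b l → l ≤ b → a C k ≤ (b + a) C (l + k)
  go zero    zero    z≤n       = ≤-refl
  go (suc b) zero    z≤n       = ≤-trans (go b zero z≤n) (nCk≤[1+n]Ck (b + a) k)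
  go (suc b) (suc l) (s≤s l≤b) = ≤-trans (go b l l≤b)
    (≤-trans (m≤m+n _ _) (≤-reflexive (nCk+nC[k+1]≡[n+1]C[k+1] (b + a) (l + k))))

0<nCk : ∀ {n k} → k ≤ n → 0 < n C k
0<nCk {n} {k} k≤n = aCk≤[a+b]C[k+l] 0 n 0 k k≤n

[1+m]C[1+k]≤[1+2m]C[1+2k] : ∀ m k → suc m C suc k ≤ suc (m + m) C (suc k + k)
[1+m]C[1+k]≤[1+2m]C[1+2k] m k with k ≤? m
... | yes k≤m = aCk≤[a+b]C[k+l] (suc m) m (suc k) k k≤m
... | no  k≰m = subst (_≤ suc (m + m) C (suc k + k)) (sym (k>n⇒nCk≡0 (s<s (≰⇒> k≰m)))) z≤n

[2+N]*[x+y]≤[A+M]+[M+B] : ∀ N x y {A M B} → N * x ≤ A → N * y ≤ B → x + y ≤ M →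
                          (2 + N) * (x + y) ≤ (A + M) + (M + B)
[2+N]*[x+y]≤[A+M]+[M+B] N x y {A} {M} {B} Nx≤A Ny≤B x+y≤M = begin
  (2 + N) * (x + y)                     ≡⟨ solve (N ∷ x ∷ y ∷ []) ⟩
  (N * x + (x + y)) + ((x + y) + N * y) ≤⟨ +-mono-≤ (+-mono-≤ Nx≤A x+y≤M) (+-mono-≤ x+y≤M Ny≤B) ⟩
  (A + M) + (M + B)                     ∎
  where open ≤-Reasoning

[1+2m]*mC[1+j]≤[1+2m]C[2+2j] : ∀ m j → suc (m + m) * (m C suc j) ≤ suc (m + m) C (suc j + suc j)
[1+2m]*mC[1+j]≤[1+2m]C[2+2j] zero    j    = z≤n
[1+2m]*mC[1+j]≤[1+2m]C[2+2j] (suc m) zero rewrite +-suc m m = begin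
  (2 + N) * (suc m C 1)             ≡⟨ cong ((2 + N) *_) (nC1≡n (suc m)) ⟩
  (2 + N) * suc m                   ≡⟨ expand ⟩
  (1 + N) + (N + N * m)             ≤⟨ +-monoʳ-≤ (1 + N) (+-monoʳ-≤ N N*m≤NC2) ⟩
  (1 + N) + (N + N C 2)             ≡⟨ cong (λ x → (1 + x) + (x + N C 2)) (nC1≡n N) ⟨
  (N C 0 + N C 1) + (N C 1 + N C 2) ≡⟨ C-pascal² N 0 ⟨
  (2 + N) C 2                       ∎
  where
  open ≤-Reasoning
  N = suc (m + m)
  expand : (3 + (m + m)) * suc m ≡ (2 + (m + m)) + (suc (m + m) + suc (m + m) * m)
  expand = solve (m ∷ [])
  N*m≤NC2 : N * m ≤ N C 2
  N*m≤NC2 = subst (λ x → N * x ≤ N C 2) (nC1≡n m) ([1+2m]*mC[1+j]≤[1+2m]C[2+2j] m 0)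
[1+2m]*mC[1+j]≤[1+2m]C[2+2j] (suc m) (suc j) rewrite +-suc m m = begin
  (2 + N) * (suc m C suc (suc j))          ≡⟨ cong ((2 + N) *_) (nCk+nC[k+1]≡[n+1]C[k+1] m (suc j)) ⟨
  (2 + N) * (m C suc j + m C suc (suc j))  ≤⟨ [2+N]*[x+y]≤[A+M]+[M+B] N (m C suc j) (m C suc (suc j))
                                                ([1+2m]*mC[1+j]≤[1+2m]C[2+2j] m j) Ny≤B x+y≤M ⟩
  (N C (suc j + suc j) + N C suc (suc j + suc j)) + (N C suc (suc j + suc j) + N C suc (suc (suc j + suc j)))
                                           ≡⟨ C-pascal² N (suc j + suc j) ⟨
  (2 + N) C (2 + (suc j + suc j))          ≡⟨ cong (λ i → (2 + N) C suc i) (+-suc (suc j) (suc j)) ⟨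
  (2 + N) C (suc (suc j) + suc (suc j))    ∎
  where
  open ≤-Reasoning
  N = suc (m + m)
  x+y≤M : m C suc j + m C suc (suc j) ≤ N C suc (suc j + suc j)
  x+y≤M = subst (_≤ N C suc (suc j + suc j)) (sym (nCk+nC[k+1]≡[n+1]C[k+1] m (suc j)))
                ([1+m]C[1+k]≤[1+2m]C[1+2k] m (suc j))
  Ny≤B : N * (m C suc (suc j)) ≤ N C suc (suc (suc j + suc j))
  Ny≤B = subst (λ i → N * (m C suc (suc j)) ≤ N C i) (cong suc (+-suc (suc j) (suc j)))
               ([1+2m]*mC[1+j]≤[1+2m]C[2+2j] m (suc j))

[1+2m]*mCj≤[1+2m]C[1+2j] : ∀ m j → j < m → suc (m + m) * (m C j) ≤ suc (m + m) C suc (j + j)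
[1+2m]*mCj≤[1+2m]C[1+2j] m j j<m = begin
  N * (m C j)          ≡⟨ cong (N *_) (k+l≡n⇒nCk≡nCl j (suc o) (trans (+-suc j o) m≡)) ⟩
  N * (m C suc o)      ≤⟨ [1+2m]*mC[1+j]≤[1+2m]C[2+2j] m o ⟩
  N C (suc o + suc o)  ≡⟨ k+l≡n⇒nCk≡nCl (suc (j + j)) (suc o + suc o)
                            (cong suc (trans (split j o) (cong₂ _+_ m≡ m≡))) ⟨
  N C suc (j + j)      ∎
  where
  open ≤-Reasoning
  N = suc (m + m)
  o = proj₁ (m≤n⇒∃[o]m+o≡n j<m)
  m≡ : suc j + o ≡ m
  m≡ = proj₂ (m≤n⇒∃[o]m+o≡n j<m)
  split : ∀ j o → (j + j) + (suc o + suc o) ≡ (suc j + o) + (suc j + o)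
  split j o = solve (j ∷ o ∷ [])

[1+2m]*[1+m]C[1+j]≤[2+2m]C[2+2j] : ∀ m j → j < m →
                                    suc (m + m) * (suc m C suc j) ≤ (suc m + suc m) C (suc j + suc j)
[1+2m]*[1+m]C[1+j]≤[2+2m]C[2+2j] m j j<m = begin
  N * (suc m C suc j)                   ≡⟨ cong (N *_) (nCk+nC[k+1]≡[n+1]C[k+1] m j) ⟨
  N * (m C j + m C suc j)               ≡⟨ *-distribˡ-+ N (m C j) (m C suc j) ⟩
  N * (m C j) + N * (m C suc j)         ≤⟨ +-mono-≤ ([1+2m]*mCj≤[1+2m]C[1+2j] m j j<m)
                                                    ([1+2m]*mC[1+j]≤[1+2m]C[2+2j] m j) ⟩
  N C suc (j + j) + N C (suc j + suc j)
                                        ≡⟨ cong₂ (λ a b → a C b + a C (suc j + suc j)) (+-suc m m) (+-suc j j) ⟨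
  (m + suc m) C (j + suc j) + (m + suc m) C (suc j + suc j)
                                        ≡⟨ nCk+nC[k+1]≡[n+1]C[k+1] (m + suc m) (j + suc j) ⟩
  (suc m + suc m) C (suc j + suc j)     ∎
  where
  open ≤-Reasoning
  N = suc (m + m)

[x+y]+[z+w]≡[y+z]+[x+w] : ∀ x y z w → (x + y) + (z + w) ≡ (y + z) + (x + w)
[x+y]+[z+w]≡[y+z]+[x+w] = solve-∀

+-mono-≤-slack : ∀ {x y u v} x′ y′ → x ≤ x′ + u → y ≤ y′ + v → x + y ≤ (x′ + y′) + (u + v)
+-mono-≤-slack {u = u} {v} x′ y′ x≤ y≤ =
  ≤-trans (+-mono-≤ x≤ y≤) (≤-reflexive (interchange x′ u y′ v))

-- Counting subsets by size and parity of the sum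

length-filter-map : ∀ {P : Pred B ℓ} (P? : Decidable P) (f : A → B) xs →
                    length (filter P? (map f xs)) ≡ length (filter (P? ∘ f) xs)
length-filter-map P? f []       = refl
length-filter-map P? f (x ∷ xs) with does (P? (f x))
... | true  = cong suc (length-filter-map P? f xs)
... | false = length-filter-map P? f xs

length-filter-parity : ∀ {P : Pred A ℓ} (P? : Decidable P) (f : A → Parity) xs →
  length (filter P? xs) ≡
  length (filter (λ x → P? x ×-dec (f x ℙ.≟ 0ℙ)) xs) +
  length (filter (λ x → P? x ×-dec (f x ℙ.≟ 1ℙ)) xs)
length-filter-parity P? f []       = refl
length-filter-parity P? f (x ∷ xs) with does (P? x) | f x
... | false | _  = length-filter-parity P? f xs
... | true  | 0ℙ = cong suc (length-filter-parity P? f xs)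
... | true  | 1ℙ = trans (cong suc (length-filter-parity P? f xs)) (sym (+-suc _ _))

length-filter-allSubsets : ∀ n {P : Pred (Subset (suc n)) ℓ} (P? : Decidable P) →
  length (filter P? (allSubsets (suc n))) ≡
  length (filter (P? ∘ (true Vec.∷_)) (allSubsets n)) + length (filter (P? ∘ (false Vec.∷_)) (allSubsets n))
length-filter-allSubsets n P? = begin
  length (filter P? (map (true Vec.∷_) S ++ map (false Vec.∷_) S))
    ≡⟨ cong length (filter-++ P? (map (true Vec.∷_) S) _) ⟩
  length (filter P? (map (true Vec.∷_) S) ++ filter P? (map (false Vec.∷_) S))
    ≡⟨ length-++ (filter P? (map (true Vec.∷_) S)) ⟩
  length (filter P? (map (true Vec.∷_) S)) + length (filter P? (map (false Vec.∷_) S))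
    ≡⟨ cong₂ _+_ (length-filter-map P? (true Vec.∷_) S) (length-filter-map P? (false Vec.∷_) S) ⟩
  length (filter (P? ∘ (true Vec.∷_)) S) + length (filter (P? ∘ (false Vec.∷_)) S) ∎
  where
  open ≡-Reasoning
  S = allSubsets n

sizeParity? : ∀ {n} k c p → Decidable {A = Subset n} (λ s → ∣ s ∣ ≡ c × parity (sumFrom k s) ≡ p)
sizeParity? k c p s = (∣ s ∣ ≟ c) ×-dec (parity (sumFrom k s) ℙ.≟ p)

-- count k n c p counts the c-subsets of {k, …, k + n − 1} whose sum has parity p.
count : ℕ → ℕ → ℕ → Parity → ℕ
count k n c p = length (filter (sizeParity? k c p) (allSubsets n))

p+q≡r⇒p+r≡q : ∀ p q r → p ℙ.+ q ≡ r → p ℙ.+ r ≡ q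
p+q≡r⇒p+r≡q 0ℙ q r eq = sym eq
p+q≡r⇒p+r≡q 1ℙ q r eq = ⁻¹-selfInverse eq

p+q⁻¹≡[p+q]⁻¹ : ∀ p q → p ℙ.+ q ⁻¹ ≡ (p ℙ.+ q) ⁻¹
p+q⁻¹≡[p+q]⁻¹ 0ℙ q = refl
p+q⁻¹≡[p+q]⁻¹ 1ℙ q = refl

p⁻¹+q≡[p+q]⁻¹ : ∀ p q → p ⁻¹ ℙ.+ q ≡ (p ℙ.+ q) ⁻¹
p⁻¹+q≡[p+q]⁻¹ 0ℙ q = refl
p⁻¹+q≡[p+q]⁻¹ 1ℙ q = sym (⁻¹-involutive q)

p⁻¹+[p+q]≡q⁻¹ : ∀ p q → p ⁻¹ ℙ.+ (p ℙ.+ q) ≡ q ⁻¹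
p⁻¹+[p+q]≡q⁻¹ 0ℙ q = refl
p⁻¹+[p+q]≡q⁻¹ 1ℙ q = refl

count-suc-zero : ∀ k n p → count k (suc n) 0 p ≡ count (suc k) n 0 p
count-suc-zero k n p = trans (length-filter-allSubsets n (sizeParity? k 0 p))
  (cong (λ s → length s + count (suc k) n 0 p)
        (filter-none (sizeParity? k 0 p ∘ (true Vec.∷_)) (universal (λ _ → λ ()) (allSubsets n))))

count-suc-suc : ∀ k n c p →
  count k (suc n) (suc c) p ≡ count (suc k) n c (parity k ℙ.+ p) + count (suc k) n (suc c) p
count-suc-suc k n c p = trans (length-filter-allSubsets n (sizeParity? k (suc c) p))
  (cong (λ s → length s + count (suc k) n (suc c) p)
        (filter-≐ (sizeParity? k (suc c) p ∘ (true Vec.∷_)) (sizeParity? (suc k) c (parity k ℙ.+ p))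
                  ((λ {s} → to s) , (λ {s} → from s)) (allSubsets n)))
  where
  to : ∀ (s : Subset n) → suc ∣ s ∣ ≡ suc c × parity (k + sumFrom (suc k) s) ≡ p →
       ∣ s ∣ ≡ c × parity (sumFrom (suc k) s) ≡ parity k ℙ.+ p
  to s (eq , par) =
    suc-injective eq , sym (p+q≡r⇒p+r≡q (parity k) _ p (trans (sym (+-homo-+ k (sumFrom (suc k) s))) par))
  from : ∀ (s : Subset n) → ∣ s ∣ ≡ c × parity (sumFrom (suc k) s) ≡ parity k ℙ.+ p →
         suc ∣ s ∣ ≡ suc c × parity (k + sumFrom (suc k) s) ≡ p
  from s (eq , par) =
    cong suc eq , trans (+-homo-+ k (sumFrom (suc k) s)) (p+q≡r⇒p+r≡q (parity k) p _ (sym par))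
count-total : ∀ k n c p → count k n c p + count k n c (p ⁻¹) ≡ n C c
count-total k zero zero 0ℙ = refl
count-total k zero zero 1ℙ = refl
count-total k zero (suc c) p = refl
count-total k (suc n) zero p
  rewrite count-suc-zero k n p | count-suc-zero k n (p ⁻¹) = count-total (suc k) n zero p
count-total k (suc n) (suc c) p = begin
  count k (suc n) (suc c) p + count k (suc n) (suc c) (p ⁻¹)
    ≡⟨ cong₂ _+_ (count-suc-suc k n c p) (count-suc-suc k n c (p ⁻¹)) ⟩
  (a (q ℙ.+ p) + b p) + (a (q ℙ.+ p ⁻¹) + b (p ⁻¹))
    ≡⟨ cong (λ r → (a (q ℙ.+ p) + b p) + (a r + b (p ⁻¹))) (p+q⁻¹≡[p+q]⁻¹ q p) ⟩
  (a (q ℙ.+ p) + b p) + (a ((q ℙ.+ p) ⁻¹) + b (p ⁻¹))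
    ≡⟨ interchange (a (q ℙ.+ p)) (b p) _ _ ⟩
  (a (q ℙ.+ p) + a ((q ℙ.+ p) ⁻¹)) + (b p + b (p ⁻¹))
    ≡⟨ cong₂ _+_ (count-total (suc k) n c (q ℙ.+ p)) (count-total (suc k) n (suc c) p) ⟩
  n C c + n C suc c
    ≡⟨ nCk+nC[k+1]≡[n+1]C[k+1] n c ⟩
  suc n C suc c ∎
  where
  open ≡-Reasoning
  q = parity k
  a b : Parity → ℕ
  a = count (suc k) n c
  b = count (suc k) n (suc c)

count-pair-zero : ∀ k n p → count k (2 + n) 0 p ≡ count (2 + k) n 0 p
count-pair-zero k n p = trans (count-suc-zero k (suc n) p) (count-suc-zero (suc k) n p)

count-pair-one : ∀ k n p → count k (2 + n) 1 p ≡ n C 0 + count (2 + k) n 1 p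
count-pair-one k n p = begin
  count k (2 + n) 1 p
    ≡⟨ count-suc-suc k (suc n) 0 p ⟩
  count (suc k) (suc n) 0 (q ℙ.+ p) + count (suc k) (suc n) 1 p
    ≡⟨ cong₂ _+_ (count-suc-zero (suc k) n (q ℙ.+ p)) (count-suc-suc (suc k) n 0 p) ⟩
  a (q ℙ.+ p) + (a (parity (suc k) ℙ.+ p) + b p)
    ≡⟨ cong (λ r → a (q ℙ.+ p) + (a (r ℙ.+ p) + b p)) (+-homo-+ 1 k) ⟩
  a (q ℙ.+ p) + (a (q ⁻¹ ℙ.+ p) + b p)
    ≡⟨ +-assoc (a (q ℙ.+ p)) _ _ ⟨
  (a (q ℙ.+ p) + a (q ⁻¹ ℙ.+ p)) + b p
    ≡⟨ cong (λ r → (a (q ℙ.+ p) + a r) + b p) (p⁻¹+q≡[p+q]⁻¹ q p) ⟩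
  (a (q ℙ.+ p) + a ((q ℙ.+ p) ⁻¹)) + b p
    ≡⟨ cong (_+ b p) (count-total (2 + k) n 0 (q ℙ.+ p)) ⟩
  n C 0 + b p ∎
  where
  open ≡-Reasoning
  q = parity k
  a b : Parity → ℕ
  a = count (2 + k) n 0
  b = count (2 + k) n 1

count-pair : ∀ k n c p →
  count k (2 + n) (2 + c) p ≡ n C suc c + (count (2 + k) n c (p ⁻¹) + count (2 + k) n (2 + c) p)
count-pair k n c p = begin
  count k (2 + n) (2 + c) p
    ≡⟨ count-suc-suc k (suc n) (suc c) p ⟩
  count (suc k) (suc n) (suc c) (q ℙ.+ p) + count (suc k) (suc n) (2 + c) p
    ≡⟨ cong₂ _+_ (count-suc-suc (suc k) n c (q ℙ.+ p)) (count-suc-suc (suc k) n (suc c) p) ⟩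
  (a (parity (suc k) ℙ.+ (q ℙ.+ p)) + b (q ℙ.+ p)) + (b (parity (suc k) ℙ.+ p) + d p)
    ≡⟨ cong (λ r → (a (r ℙ.+ (q ℙ.+ p)) + b (q ℙ.+ p)) + (b (r ℙ.+ p) + d p)) (+-homo-+ 1 k) ⟩
  (a (q ⁻¹ ℙ.+ (q ℙ.+ p)) + b (q ℙ.+ p)) + (b (q ⁻¹ ℙ.+ p) + d p)
    ≡⟨ cong₂ (λ r s → (a r + b (q ℙ.+ p)) + (b s + d p))
             (p⁻¹+[p+q]≡q⁻¹ q p) (p⁻¹+q≡[p+q]⁻¹ q p) ⟩
  (a (p ⁻¹) + b (q ℙ.+ p)) + (b ((q ℙ.+ p) ⁻¹) + d p)
    ≡⟨ [x+y]+[z+w]≡[y+z]+[x+w] (a (p ⁻¹)) _ _ _ ⟩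
  (b (q ℙ.+ p) + b ((q ℙ.+ p) ⁻¹)) + (a (p ⁻¹) + d p)
    ≡⟨ cong (_+ (a (p ⁻¹) + d p)) (count-total (2 + k) n (suc c) (q ℙ.+ p)) ⟩
  n C suc c + (a (p ⁻¹) + d p) ∎
  where
  open ≡-Reasoning
  q = parity k
  a b d : Parity → ℕ
  a = count (2 + k) n c
  b = count (2 + k) n (suc c)
  d = count (2 + k) n (2 + c)

-- gap m c is the absolute value of the coefficient of xᶜ in (1 − x²)ᵐ.
gap : ℕ → ℕ → ℕ
gap m       zero          = 1
gap m       (suc zero)    = 0
gap zero    (suc (suc c)) = 0
gap (suc m) (suc (suc c)) = gap m c + gap m (suc (suc c))

gap-even : ∀ m j → gap m (j + j) ≡ m C j
gap-even m       zero    = refl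
gap-even zero    (suc j) rewrite +-suc j j = refl
gap-even (suc m) (suc j) rewrite +-suc j j = begin
  gap m (j + j) + gap m (suc (suc (j + j)))
    ≡⟨ cong₂ _+_ (gap-even m j) (trans (cong (λ i → gap m (suc i)) (sym (+-suc j j))) (gap-even m (suc j))) ⟩
  m C j + m C suc j
    ≡⟨ nCk+nC[k+1]≡[n+1]C[k+1] m j ⟩
  suc m C suc j ∎
  where open ≡-Reasoning

gap-odd : ∀ m j → gap m (suc (j + j)) ≡ 0
gap-odd m       zero    = refl
gap-odd zero    (suc j) = refl
gap-odd (suc m) (suc j) rewrite +-suc j j =
  cong₂ _+_ (gap-odd m j) (trans (cong (λ i → gap m (2 + i)) (sym (+-suc j j))) (gap-odd m (suc j)))

count-gap : ∀ m k c p → count k (m + m) c p ≤ count k (m + m) c (p ⁻¹) + gap m c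
count-gap zero    k zero    p =
  ≤-trans (length-filter (sizeParity? k 0 p) (allSubsets 0)) (m≤n+m 1 (count k 0 0 (p ⁻¹)))
count-gap zero    k (suc c) p = z≤n
count-gap (suc m) k c p rewrite +-suc m m = step c
  where
  n = m + m
  ih : ∀ c p → count (2 + k) n c p ≤ count (2 + k) n c (p ⁻¹) + gap m c
  ih = count-gap m (2 + k)
  ih⁻¹ : ∀ c → count (2 + k) n c (p ⁻¹) ≤ count (2 + k) n c p + gap m c
  ih⁻¹ c = subst (λ r → count (2 + k) n c (p ⁻¹) ≤ count (2 + k) n c r + gap m c)
                 (⁻¹-involutive p) (ih c (p ⁻¹))
  step : ∀ c → count k (2 + n) c p ≤ count k (2 + n) c (p ⁻¹) + gap (suc m) c
  step zero
    rewrite count-pair-zero k n p | count-pair-zero k n (p ⁻¹) = ih 0 p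
  step (suc zero)
    rewrite count-pair-one k n p | count-pair-one k n (p ⁻¹) =
      ≤-trans (+-monoʳ-≤ (n C 0) (ih 1 p)) (≤-reflexive (sym (+-assoc (n C 0) (count (2 + k) n 1 (p ⁻¹)) 0)))
  step (suc (suc c))
    rewrite count-pair k n c p | count-pair k n c (p ⁻¹) | ⁻¹-involutive p =
      ≤-trans (+-monoʳ-≤ (n C suc c) (+-mono-≤-slack (count (2 + k) n c p) (count (2 + k) n (2 + c) (p ⁻¹))
                                                      (ih⁻¹ c) (ih (2 + c) p)))
              (≤-reflexive (sym (+-assoc (n C suc c) (count (2 + k) n c p + count (2 + k) n (2 + c) (p ⁻¹)) _)))

count-gap-suc : ∀ m k c p →
  count k (suc (m + m)) (suc c) p ≤ count k (suc (m + m)) (suc c) (p ⁻¹) + (gap m c + gap m (suc c))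
count-gap-suc m k c p
  rewrite count-suc-suc k (m + m) c p | count-suc-suc k (m + m) c (p ⁻¹) | p+q⁻¹≡[p+q]⁻¹ (parity k) p =
    +-mono-≤-slack (count (suc k) (m + m) c ((parity k ℙ.+ p) ⁻¹)) (count (suc k) (m + m) (suc c) (p ⁻¹))
                   (count-gap m (suc k) c (parity k ℙ.+ p)) (count-gap m (suc k) (suc c) p)

-- From counts to probabilities

ratio-mono : ∀ a b c d → a * suc d ≤ c * suc b → ratio a (suc b) ℚ.≤ ratio c (suc d)
ratio-mono a b c d ad≤cb = toℚᵘ-cancel-≤
  (ℚᵘ.≤-respˡ-≃ (ℚᵘ.≃-sym (toℚᵘ-fromℚᵘ (mkℚᵘ (+ a) b)))
  (ℚᵘ.≤-respʳ-≃ (ℚᵘ.≃-sym (toℚᵘ-fromℚᵘ (mkℚᵘ (+ c) d)))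
  (*≤* (subst₂ ℤ._≤_ (ℤ.pos-* a (suc d)) (ℤ.pos-* c (suc b)) (+≤+ ad≤cb)))))

½*[1+1/[1+d]]≡[2+d]/[2+2d] : ∀ d → ½ ℚ.* (1ℚ ℚ.+ ratio 1 (suc d)) ≡ ratio (2 + d) (2 + (d + d))
½*[1+1/[1+d]]≡[2+d]/[2+2d] d = toℚᵘ-injective (begin
  toℚᵘ (½ ℚ.* (1ℚ ℚ.+ ratio 1 (suc d)))
    ≈⟨ toℚᵘ-homo-* ½ (1ℚ ℚ.+ ratio 1 (suc d)) ⟩
  toℚᵘ ½ ℚᵘ.* toℚᵘ (1ℚ ℚ.+ ratio 1 (suc d))
    ≈⟨ ℚᵘ.*-cong (toℚᵘ-fromℚᵘ (mkℚᵘ (+ 1) 1)) (toℚᵘ-homo-+ 1ℚ (ratio 1 (suc d))) ⟩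
  mkℚᵘ (+ 1) 1 ℚᵘ.* (toℚᵘ 1ℚ ℚᵘ.+ toℚᵘ (ratio 1 (suc d)))
    ≈⟨ ℚᵘ.*-congˡ {mkℚᵘ (+ 1) 1}
         (ℚᵘ.+-cong (toℚᵘ-fromℚᵘ (mkℚᵘ (+ 1) 0)) (toℚᵘ-fromℚᵘ (mkℚᵘ (+ 1) d))) ⟩
  mkℚᵘ (+ 1) 1 ℚᵘ.* (mkℚᵘ (+ 1) 0 ℚᵘ.+ mkℚᵘ (+ 1) d)
    ≈⟨ *≡* (cong +_ (solve (d ∷ []))) ⟩
  mkℚᵘ (+ (2 + d)) (suc (d + d))
    ≈⟨ toℚᵘ-fromℚᵘ (mkℚᵘ (+ (2 + d)) (suc (d + d))) ⟨
  toℚᵘ (ratio (2 + d) (2 + (d + d))) ∎)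
  where open ℚᵘ.≃-Reasoning

x+y≡z⇒x≤y+h⇒x+x≤z+h : ∀ {x y z h} → x + y ≡ z → x ≤ y + h → x + x ≤ z + h
x+y≡z⇒x≤y+h⇒x+x≤z+h {x} {y} {z} {h} x+y≡z x≤y+h = begin
  x + x       ≤⟨ +-monoʳ-≤ x x≤y+h ⟩
  x + (y + h) ≡⟨ +-assoc x y h ⟨
  x + y + h   ≡⟨ cong (_+ h) x+y≡z ⟩
  z + h       ∎
  where open ≤-Reasoning

ratio≤½ : ∀ {G T} → 0 < T → G + G ≤ T → ratio G T ℚ.≤ ½
ratio≤½ {G} {suc t} _ G+G≤T = ratio-mono G t 1 1 (begin
  G * 2   ≡⟨ solve (G ∷ []) ⟩
  G + G   ≤⟨ G+G≤T ⟩
  suc t   ≡⟨ +-identityʳ (suc t) ⟨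
  1 * suc t ∎)
  where open ≤-Reasoning

ratio≤½*[1+1/[1+d]] : ∀ {G T h} d → 0 < T → G + G ≤ T + h → suc d * h ≤ T →
                      ratio G T ℚ.≤ ½ ℚ.* (1ℚ ℚ.+ ratio 1 (suc d))
ratio≤½*[1+1/[1+d]] {G} {suc t} {h} d _ G+G≤T+h dh≤T
  rewrite ½*[1+1/[1+d]]≡[2+d]/[2+2d] d = ratio-mono G t (2 + d) (suc (d + d)) (begin
    G * (2 + (d + d))           ≡⟨ e₁ G d ⟩
    (G + G) * suc d             ≤⟨ *-monoˡ-≤ (suc d) G+G≤T+h ⟩
    (T + h) * suc d             ≡⟨ e₂ T h d ⟩
    T * suc d + suc d * h       ≤⟨ +-monoʳ-≤ (T * suc d) dh≤T ⟩
    T * suc d + T               ≡⟨ e₃ T d ⟩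
    (2 + d) * T                 ∎)
  where
  open ≤-Reasoning
  T = suc t
  e₁ : ∀ G d → G * (2 + (d + d)) ≡ (G + G) * suc d
  e₁ = solve-∀
  e₂ : ∀ T h d → (T + h) * suc d ≡ T * suc d + suc d * h
  e₂ = solve-∀
  e₃ : ∀ T d → T * suc d + T ≡ (2 + d) * T
  e₃ = solve-∀

data Halves : ℕ → Set where
  even : ∀ m → Halves (m + m)
  odd  : ∀ m → Halves (suc (m + m))

halves : ∀ n → Halves n
halves zero = even 0
halves (suc n) with halves n
... | even m = odd m
... | odd  m = subst Halves (cong suc (+-suc m m)) (even (suc m))

[m+m]%2≢1 : ∀ m → (m + m) % 2 ≢ 1
[m+m]%2≢1 zero    ()
[m+m]%2≢1 (suc m) rewrite +-suc m m = [m+m]%2≢1 m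

[1+m+m]%2≢0 : ∀ m → suc (m + m) % 2 ≢ 0
[1+m+m]%2≢0 zero    ()
[1+m+m]%2≢0 (suc m) rewrite +-suc m m = [1+m+m]%2≢0 m

m+m<n+n⇒m<n : ∀ {m n} → m + m < n + n → m < n
m+m<n+n⇒m<n m+m<n+n = ≰⇒> (λ n≤m → <⇒≱ m+m<n+n (+-mono-≤ n≤m n≤m))

toParity : Fin 2 → Parity
toParity Fin.zero           = 0ℙ
toParity (Fin.suc Fin.zero) = 1ℙ

%2≡⇒parity≡ : ∀ x i → x % 2 ≡ toℕ i → parity x ≡ toParity i
%2≡⇒parity≡ zero          Fin.zero           _  = refl
%2≡⇒parity≡ zero          (Fin.suc Fin.zero) ()
%2≡⇒parity≡ (suc zero)    Fin.zero           ()
%2≡⇒parity≡ (suc zero)    (Fin.suc Fin.zero) _  = refl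
%2≡⇒parity≡ (suc (suc x)) i                  eq = %2≡⇒parity≡ x i eq

parity≡⇒%2≡ : ∀ x i → parity x ≡ toParity i → x % 2 ≡ toℕ i
parity≡⇒%2≡ zero          Fin.zero           _  = refl
parity≡⇒%2≡ zero          (Fin.suc Fin.zero) ()
parity≡⇒%2≡ (suc zero)    Fin.zero           ()
parity≡⇒%2≡ (suc zero)    (Fin.suc Fin.zero) _  = refl
parity≡⇒%2≡ (suc (suc x)) i                  eq = parity≡⇒%2≡ x i eq

[1+2m]*gap≤[1+2m]C[1+c] : ∀ m c → c < m + m →
                          suc (m + m) * (gap m c + gap m (suc c)) ≤ suc (m + m) C suc c
[1+2m]*gap≤[1+2m]C[1+c] m c c<2m with halves c
... | even j = begin
  N * (gap m (j + j) + gap m (suc (j + j))) ≡⟨ cong (λ g → N * (gap m (j + j) + g)) (gap-odd m j) ⟩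
  N * (gap m (j + j) + 0)                   ≡⟨ cong (N *_) (trans (+-identityʳ _) (gap-even m j)) ⟩
  N * (m C j)                               ≤⟨ [1+2m]*mCj≤[1+2m]C[1+2j] m j (m+m<n+n⇒m<n c<2m) ⟩
  N C suc (j + j)                           ∎
  where
  open ≤-Reasoning
  N = suc (m + m)
... | odd j = begin
  N * (gap m (suc (j + j)) + gap m (2 + (j + j))) ≡⟨ cong (λ g → N * (g + gap m (2 + (j + j)))) (gap-odd m j) ⟩
  N * gap m (2 + (j + j))                         ≡⟨ cong (λ i → N * gap m (suc i)) (+-suc j j) ⟨
  N * gap m (suc j + suc j)                       ≡⟨ cong (N *_) (gap-even m (suc j)) ⟩
  N * (m C suc j)                                 ≤⟨ [1+2m]*mC[1+j]≤[1+2m]C[2+2j] m j ⟩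
  N C (suc j + suc j)                             ≡⟨ cong (λ i → N C suc i) (+-suc j j) ⟩
  N C (2 + (j + j))                               ∎
  where
  open ≤-Reasoning
  N = suc (m + m)

even-odd-bound : ∀ n c p → c < n → n % 2 ≡ 0 → c % 2 ≡ 1 → ratio (count 1 n c p) (n C c) ℚ.≤ ½
even-odd-bound n c p c<n n%2 c%2 with halves n | halves c
... | odd m  | _      = ⊥-elim ([1+m+m]%2≢0 m n%2)
... | even m | even j = ⊥-elim ([m+m]%2≢1 j c%2)
... | even m | odd j  = ratio≤½ (0<nCk (<⇒≤ c<n))
  (≤-trans (x+y≡z⇒x≤y+h⇒x+x≤z+h (count-total 1 (m + m) c p) (count-gap m 1 c p))
           (≤-reflexive (trans (cong (λ h → (m + m) C c + h) (gap-odd m j)) (+-identityʳ _))))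

even-even-bound : ∀ n c p → 0 < c → c < n → n % 2 ≡ 0 → c % 2 ≡ 0 →
                  ratio (count 1 n c p) (n C c) ℚ.≤ ½ ℚ.* (1ℚ ℚ.+ ratio 1 (n ∸ 1))
even-even-bound n c p 0<c c<n n%2 c%2 with halves n | halves c
... | odd m  | _      = ⊥-elim ([1+m+m]%2≢0 m n%2)
... | even m | odd j  = ⊥-elim ([1+m+m]%2≢0 j c%2)
even-even-bound _ _ p 0<c () n%2 c%2 | even zero    | even j
even-even-bound _ _ p () c<n n%2 c%2 | even (suc m) | even zero
even-even-bound _ _ p 0<c c<n n%2 c%2 | even (suc m) | even (suc j) =
  subst (λ d → ratio (count 1 n c p) (n C c) ℚ.≤ ½ ℚ.* (1ℚ ℚ.+ ratio 1 d)) (sym (+-suc m m))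
    (ratio≤½*[1+1/[1+d]] (m + m) (0<nCk (<⇒≤ c<n))
      (x+y≡z⇒x≤y+h⇒x+x≤z+h (count-total 1 n c p) (count-gap (suc m) 1 c p))
      (subst (λ h → suc (m + m) * h ≤ n C c) (sym (gap-even (suc m) (suc j)))
             ([1+2m]*[1+m]C[1+j]≤[2+2m]C[2+2j] m j (s<s⁻¹ (m+m<n+n⇒m<n c<n)))))
  where
  n = suc m + suc m
  c = suc j + suc j

odd-bound : ∀ n c p → 0 < c → c < n → n % 2 ≡ 1 →
            ratio (count 1 n c p) (n C c) ℚ.≤ ½ ℚ.* (1ℚ ℚ.+ ratio 1 n)
odd-bound n c p 0<c c<n n%2 with halves n
... | even m = ⊥-elim ([m+m]%2≢1 m n%2)
odd-bound _ (suc c) p _ c<n _ | odd m =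
  ratio≤½*[1+1/[1+d]] (m + m) (0<nCk (<⇒≤ c<n))
    (x+y≡z⇒x≤y+h⇒x+x≤z+h (count-total 1 (suc (m + m)) (suc c) p) (count-gap-suc m 1 c p))
    ([1+2m]*gap≤[1+2m]C[1+c] m c (s<s⁻¹ c<n))

length-cSubsets : ∀ n c → length (filter (λ (s : Subset n) → ∣ s ∣ ≟ c) (allSubsets n)) ≡ n C c
length-cSubsets n c =
  trans (length-filter-parity (λ (s : Subset n) → ∣ s ∣ ≟ c) (parity ∘ sumFrom 1) (allSubsets n))
        (count-total 1 n c 0ℙ)

length-good : ∀ n c i →
  length (filter (λ (s : Subset n) → (∣ s ∣ ≟ c) ×-dec (subsetSum s % 2 ≟ toℕ i)) (allSubsets n)) ≡
  count 1 n c (toParity i)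
length-good n c i = cong length (filter-≐ _ (sizeParity? 1 c (toParity i))
  ((λ {s} (eq , par) → eq , %2≡⇒parity≡ (subsetSum s) i par) ,
   (λ {s} (eq , par) → eq , parity≡⇒%2≡ (subsetSum s) i par))
  (allSubsets n))

lemma1 : (n c : ℕ) → 0 < c → c < n → (i : Fin 2) →
  let cSubsets = filter (λ (s : Subset n) → ∣ s ∣ ≟ c) (allSubsets n)
      good = filter (λ (s : Subset n) → (∣ s ∣ ≟ c) ×-dec (subsetSum s % 2 ≟ toℕ i)) (allSubsets n)
      P = ratio (length good) (length cSubsets)
  in (n % 2 ≡ 0 → c % 2 ≡ 1 → P ℚ.≤ ½)
     × (n % 2 ≡ 0 → c % 2 ≡ 0 → P ℚ.≤ ½ ℚ.* (1ℚ ℚ.+ ratio 1 (n ∸ 1)))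
     × (n % 2 ≡ 1 → P ℚ.≤ ½ ℚ.* (1ℚ ℚ.+ ratio 1 n))
lemma1 n c 0<c c<n i rewrite length-good n c i | length-cSubsets n c =
  even-odd-bound n c p c<n , even-even-bound n c p 0<c c<n , odd-bound n c p 0<c c<n
  where p = toParity i
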